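{- Let $k\ge 3$ and let $\mathcal{H}$ be a simple connected $k$-uniform hypergraph. Suppose there exist two vertices $v_i$ and $v_j$ with Laplacian degrees satisfying $\delta_i\geq\delta_j\geq 2(k-1)$, and an edge $e\in E(\mathcal{H})$ with $v_j\in e$ and $v_i\notin e$. Let $\mathcal{H}'$ be the hypergraph obtained from $\mathcal{H}$ by moving the edge $e$ from $v_j$ to $v_i$. Then $h(\mathcal{H})<h(\mathcal{H}')$.
   Context: For distinct vertices $v_i,v_j$ of a hypergraph $\mathcal{H}$ on vertex set $\{v_1,\dots,v_n\}$, let $a_{ij}$ be the number of edges containing both $v_i$ and $v_j$ (with $a_{ii}=0$); the Laplacian degree of $v_i$ is $\delta_i=\sum_{j=1}^n a_{ij}$. Define $h(\mathcal{H})=\sum_{i=1}^n\delta_i\log_2\delta_i$, where the Laplacian degrees are computed in $\mathcal{H}$ (and for $h(\mathcal{H}')$, in $\mathcal{H}'$). Moving an edge: if $u\notin e\in E(\mathcal{H})$ and $v\in e$, put $e'=(e\setminus\{v\})\cup\{u\}$; the hypergraph with the same vertex set and edge set $(E(\mathcal{H})\setminus\{e\})\cup\{e'\}$ is said to be obtained from $\mathcal{H}$ by moving the edge $e$ from $v$ to $u$. -}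

module Defs where

open import Data.Nat using (ℕ; zero; suc; _*_; _^_)
open import Data.Fin using (Fin)
open import Data.Fin.Properties using (_≟_)
open import Data.Fin.Subset using (Subset; _∈_; ∣_∣; inside; outside)
open import Data.Fin.Subset.Properties using (_∈?_)
open import Data.Vec using (_[_]≔_)
open import Data.List using (List; length; filter; map; allFin; _[_]∷=_)
open import Data.Nat.ListAction using (sum; product)
open import Data.List.Relation.Unary.All using (All)
open import Data.List.Relation.Unary.Any using (Any)
open import Data.List.Relation.Unary.Unique.Propositional using (Unique)
open import Data.Product using (_×_)
open import Relation.Binary.PropositionalEquality using (_≡_)
open import Relation.Nullary using (yes; no)
open import Relation.Nullary.Decidable using (_×-dec_)
open import Relation.Binary.Construct.Closure.ReflexiveTransitive using (Star)

-- A hypergraph on vertex set Fin n (vertices v_1..v_n): a list of edges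
-- (list = multiset of edges), each edge a subset of the vertex set.
Edges : ℕ → Set
Edges n = List (Subset n)

Uniform : ∀ {n} → ℕ → Edges n → Set
Uniform k E = All (λ e → ∣ e ∣ ≡ k) E

-- simple: no repeated edges (loops are excluded by uniformity with k ≥ 3)
Simple : ∀ {n} → Edges n → Set
Simple E = Unique E

Adjacent : ∀ {n} → Edges n → Fin n → Fin n → Set
Adjacent E u v = Any (λ e → (u ∈ e) × (v ∈ e)) E

Connected : ∀ {n} → Edges n → Set
Connected E = ∀ u v → Star (Adjacent E) u v

a : ∀ {n} → Edges n → Fin n → Fin n → ℕ
a E i j with i ≟ j
... | yes _ = 0
... | no _  = length (filter (λ e → (i ∈? e) ×-dec (j ∈? e)) E)

δ : ∀ {n} → Edges n → Fin n → ℕ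
δ {n} E i = sum (map (a E i) (allFin n))

-- 2^{h(H)} = ∏_i δ_i ^ δ_i  (with 0^0 = 1, matching 0 log 0 = 0);
-- h(H) < h(H') iff expH H < expH H' since log₂ is strictly increasing.
expH : ∀ {n} → Edges n → ℕ
expH {n} E = product (map (λ i → δ E i ^ δ E i) (allFin n))

-- moving an edge e (given by its position p in the edge list) from v to u:
-- e' = (e \ {v}) ∪ {u} replaces e.
moveEdge : ∀ {n} (E : Edges n) → Fin (length E) → (v u : Fin n) → Edges n
moveEdge E p v u = E [ p ]∷= ((Data.List.lookup E p [ v ]≔ outside) [ u ]≔ inside)
  where import Data.List

{-# OPTIONS --safe #-}
-- Since v_j ∈ e and v_i ∉ e, moving e from v_j to v_i replaces e by its image under the
-- transposition (v_i v_j). Hence δ_i grows by m = δ_e(v_j) = |e| - 1 > 0, δ_j drops by m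
-- and every other Laplacian degree is unchanged. Now 2^h = ∏ δ^δ (with 0^0 = 1), and
-- t ↦ t^t is strictly log-convex on ℕ: the ratios (t + 1)^(t + 1) / t^t increase. So
-- transferring m from the smaller degree δ_j to the larger δ_i increases the product.

module Submission where

open import Defs
open import Data.Nat using (ℕ; _≤_; _<_; _*_; _∸_)
open import Data.Fin using (Fin)
open import Data.Fin.Subset using (_∈_; _∉_)
open import Data.List using (length; lookup)

open import Data.Nat using (zero; suc; _+_; _^_; NonZero; s≤s; z≤n; z<s)
open import Data.Nat.Properties hiding (_≟_; suc-injective)
open import Data.Nat.Tactic.RingSolver using (solve-∀; solve)
open import Data.Nat.ListAction using (sum; product)
open import Data.Nat.ListAction.Properties using (product≢0)
open import Data.Fin using (zero; suc)
open import Data.Fin.Properties using (_≟_; suc-injective)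
open import Data.Fin.Subset using (Subset; _⊆_; ∣_∣; ⁅_⁆; inside; outside)
open import Data.Fin.Subset.Properties using (_∈?_; x∈⁅x⁆; ∣⁅x⁆∣≡1; p⊆q⇒∣p∣≤∣q∣)
open import Data.Fin.Permutation using (Permutation; _⟨$⟩ʳ_; transpose)
import Data.Fin.Permutation.Components as PC
open import Data.Vec using (_[_]≔_)
import Data.Vec as Vec
open import Data.Vec.Properties using ([]=⇒lookup; lookup⇒[]=; lookup∘update; lookup∘update′)
open import Data.Vec.Functional using (updateAt)
open import Data.Vec.Functional.Properties using (updateAt-updates; updateAt-minimal)
open import Data.Bool.Properties using (¬-not)
open import Data.List using ([]; _∷_; tabulate; _[_]∷=_)
open import Data.List.Properties using (map-tabulate; tabulate-cong)
open import Data.List.Membership.Propositional.Properties using (∈-lookup)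
import Data.List.Relation.Unary.All as All
open import Data.List.Relation.Unary.All.Properties using (tabulate⁺)
open import Data.Sum using (inj₁; inj₂)
open import Algebra.Properties.CommutativeMonoid.Sum +-0-commutativeMonoid
  using (sum-syntax; ∑-distrib-+; sum-permute; sum-cong-≗; sum-replicate-zero)
open import Algebra.Properties.CommutativeSemigroup +-commutativeSemigroup using ()
  renaming (xy∙z≈zy∙x to +-xy∙z≈zy∙x)
open import Algebra.Properties.CommutativeSemigroup *-commutativeSemigroup using ()
  renaming (interchange to *-interchange; xy∙z≈x∙zy to *-xy∙z≈x∙zy;
            xy∙z≈zy∙x to *-xy∙z≈zy∙x; xy∙z≈xz∙y to *-xy∙z≈xz∙y)
open import Function using (id; _∘_; Injection)
open import Function.Properties.Inverse using (↔⇒↣)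
open import Relation.Binary.PropositionalEquality
open import Relation.Nullary using (Dec; yes; no; contradiction)
open import Relation.Nullary.Decidable using (dec-true; dec-false)

private
  variable
    n : ℕ

-- Strict log-convexity of t ↦ t^t

-- f (s + 1) / f s < f (t + 1) / f t, cross-multiplied.
RatioLess : (ℕ → ℕ) → ℕ → ℕ → Set
RatioLess f s t = f (suc s) * f t < f (suc t) * f s

*-cross-<-trans : ∀ a b c d e g → a * d < c * b → c * g < e * d → a * g < e * b
*-cross-<-trans a b c d e g ad<cb cg<ed = *-cancelʳ-< (c * d) (a * g) (e * b) (begin-strict
    a * g * (c * d)  ≡⟨ solve (a ∷ c ∷ d ∷ g ∷ []) ⟩
    a * d * (c * g)  <⟨ *-mono-< ad<cb cg<ed ⟩
    c * b * (e * d)  ≡⟨ solve (b ∷ c ∷ d ∷ e ∷ []) ⟩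
    e * b * (c * d)  ∎)
  where open ≤-Reasoning

RatioLess-trans : ∀ {f r s t} → RatioLess f r s → RatioLess f s t → RatioLess f r t
RatioLess-trans {f} {r} {s} {t} = *-cross-<-trans (f (suc r)) (f r) (f (suc s)) (f s) (f (suc t)) (f t)

StrictlyLogConvex : (ℕ → ℕ) → Set
StrictlyLogConvex f = ∀ t → RatioLess f t (suc t)

module _ {f : ℕ → ℕ} (convex : StrictlyLogConvex f) where

  ratio-< : ∀ {s t} → s < t → RatioLess f s t
  ratio-< {s} {suc t} s<1+t with m<1+n⇒m<n∨m≡n s<1+t
  ... | inj₁ s<t  = RatioLess-trans {f} (ratio-< s<t) (convex t)
  ... | inj₂ refl = convex s

  transfer-< : ∀ {m x z} → 0 < m → m + z ≤ x → f (m + z) * f x < f (m + x) * f z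
  transfer-< {suc zero}    _ z<x = ratio-< z<x
  transfer-< {suc (suc m)} {x} {z} _ m+z<x = <-trans (ratio-< m+z<x) (begin-strict
    f (suc x) * f (suc m + z)  ≡⟨ *-comm (f (suc x)) _ ⟩
    f (suc m + z) * f (suc x)  <⟨ transfer-< z<s (m≤n⇒m≤1+n (<⇒≤ m+z<x)) ⟩
    f (suc m + suc x) * f z    ≡⟨ cong (λ y → f y * f z) (+-suc (suc m) x) ⟩
    f (suc (suc m) + x) * f z  ∎)
    where open ≤-Reasoning

[m*n]^o≡m^o*n^o : ∀ m n o → (m * n) ^ o ≡ m ^ o * n ^ o
[m*n]^o≡m^o*n^o m n zero    = refl
[m*n]^o≡m^o*n^o m n (suc o) = begin
  m * n * (m * n) ^ o      ≡⟨ cong (m * n *_) ([m*n]^o≡m^o*n^o m n o) ⟩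
  m * n * (m ^ o * n ^ o)  ≡⟨ *-interchange m n (m ^ o) (n ^ o) ⟩
  m * m ^ o * (n * n ^ o)  ∎
  where open ≡-Reasoning

[1+c]^[1+n]≤c^[1+n]+[1+n]*[1+c]^n : ∀ c n → suc c ^ suc n ≤ c ^ suc n + suc n * suc c ^ n
[1+c]^[1+n]≤c^[1+n]+[1+n]*[1+c]^n c zero    = ≤-reflexive (+-comm 1 (c * 1))
[1+c]^[1+n]≤c^[1+n]+[1+n]*[1+c]^n c (suc n) = begin
  suc c * suc c ^ suc n                               ≤⟨ *-monoʳ-≤ (suc c) ([1+c]^[1+n]≤c^[1+n]+[1+n]*[1+c]^n c n) ⟩
  suc c * (c ^ suc n + suc n * suc c ^ n)             ≡⟨ identity c (c ^ suc n) (suc c ^ n) n ⟩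
  c * c ^ suc n + (c ^ suc n + suc n * suc c ^ suc n) ≤⟨ +-monoʳ-≤ (c * c ^ suc n) (+-monoˡ-≤ _ (^-monoˡ-≤ (suc n) (n≤1+n c))) ⟩
  c * c ^ suc n + (suc c ^ suc n + suc n * suc c ^ suc n) ∎
  where
  open ≤-Reasoning
  identity : ∀ c x y n → suc c * (x + suc n * y) ≡ c * x + (x + suc n * (suc c * y))
  identity = solve-∀

n^n≢0 : ∀ n → NonZero (n ^ n)
n^n≢0 zero    = _
n^n≢0 (suc n) = m^n≢0 (suc n) (suc n)

n^n-strictlyLogConvex : StrictlyLogConvex (λ n → n ^ n)
n^n-strictlyLogConvex zero    = s≤s (s≤s z≤n)
n^n-strictlyLogConvex (suc t) = begin-strict
  u ^ u * u ^ u          ≡⟨ [m*n]^o≡m^o*n^o u u u ⟨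
  u * u * X              ≡⟨ *-assoc u u X ⟩
  u * (u * X)            ≤⟨ *-monoʳ-≤ u u*X≤Q ⟩
  u * Q                  <⟨ *-monoˡ-< Q {{Q≢0}} (n<1+n u) ⟩
  suc u * Q              ≡⟨ *-assoc (suc u) (suc u ^ u) (T ^ T) ⟨
  suc u ^ suc u * T ^ T  ∎
  where
  open ≤-Reasoning
  T = suc t
  u = suc T
  c = T * suc u
  X = (u * u) ^ T
  Q = suc u ^ u * T ^ T
  Q≢0 : NonZero Q
  Q≢0 = m*n≢0 (suc u ^ u) (T ^ T) {{m^n≢0 (suc u) u}} {{m^n≢0 T T}}
  u*u≡1+c : u * u ≡ suc c
  u*u≡1+c = identity t
    where
    identity : ∀ t → suc (suc t) * suc (suc t) ≡ suc (suc t * suc (suc (suc t)))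
    identity = solve-∀
  -- u^(2T + 1) ≤ (u + 1)^u T^T: the mean-value bound at c + 1 = u²
  u*X≤Q : u * X ≤ Q
  u*X≤Q = *-cancelˡ-≤ T (+-cancelʳ-≤ (u * X) (T * (u * X)) (T * Q) (begin
    T * (u * X) + u * X              ≡⟨ +-comm (T * (u * X)) (u * X) ⟩
    u * (u * X)                      ≡⟨ *-assoc u u X ⟨
    (u * u) ^ suc T                  ≡⟨ cong (_^ suc T) u*u≡1+c ⟩
    suc c ^ suc T                    ≤⟨ [1+c]^[1+n]≤c^[1+n]+[1+n]*[1+c]^n c T ⟩
    c ^ suc T + u * suc c ^ T        ≡⟨ cong₂ (λ a b → a + u * b ^ T) c^[1+T]≡T*Q (sym u*u≡1+c) ⟩
    T * Q + u * X                    ∎))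
    where
    c^[1+T]≡T*Q : c ^ suc T ≡ T * Q
    c^[1+T]≡T*Q = begin-equality
      (T * suc u) ^ suc T        ≡⟨ [m*n]^o≡m^o*n^o T (suc u) (suc T) ⟩
      T * T ^ T * suc u ^ u      ≡⟨ *-xy∙z≈x∙zy T (T ^ T) (suc u ^ u) ⟩
      T * (suc u ^ u * T ^ T)    ∎

-- Finite sums and products over Fin n

sum-tabulate : (f : Fin n → ℕ) → sum (tabulate f) ≡ ∑[ i < n ] f i
sum-tabulate {zero}  f = refl
sum-tabulate {suc n} f = cong (f zero +_) (sum-tabulate (f ∘ suc))

term≤∑ : (f : Fin n → ℕ) (k : Fin n) → f k ≤ ∑[ i < n ] f i
term≤∑ f zero    = m≤m+n _ _
term≤∑ f (suc k) = ≤-trans (term≤∑ (f ∘ suc) k) (m≤n+m _ _)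

product-tabulate-exchange : {F F′ : Fin n → ℕ} (v : Fin n) → (∀ k → k ≢ v → F k ≡ F′ k) →
                            product (tabulate F) * F′ v ≡ product (tabulate F′) * F v
product-tabulate-exchange {F = F} {F′} zero F≗F′ = begin
  F zero * product (tabulate (F ∘ suc)) * F′ zero    ≡⟨ cong (λ xs → F zero * product xs * F′ zero)
                                                          (tabulate-cong (λ k → F≗F′ (suc k) λ ())) ⟩
  F zero * product (tabulate (F′ ∘ suc)) * F′ zero   ≡⟨ *-xy∙z≈zy∙x (F zero) _ (F′ zero) ⟩
  F′ zero * product (tabulate (F′ ∘ suc)) * F zero   ∎
  where open ≡-Reasoning
product-tabulate-exchange {F = F} {F′} (suc v) F≗F′ = begin
  F zero * product (tabulate (F ∘ suc)) * F′ (suc v)     ≡⟨ *-assoc (F zero) _ _ ⟩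
  F zero * (product (tabulate (F ∘ suc)) * F′ (suc v))   ≡⟨ cong₂ _*_ (F≗F′ zero λ ())
                                                              (product-tabulate-exchange v λ k k≢v → F≗F′ (suc k) (k≢v ∘ suc-injective)) ⟩
  F′ zero * (product (tabulate (F′ ∘ suc)) * F (suc v))  ≡⟨ *-assoc (F′ zero) _ _ ⟨
  F′ zero * product (tabulate (F′ ∘ suc)) * F (suc v)    ∎
  where open ≡-Reasoning

product-tabulate-exchange₂ : {F F′ : Fin n → ℕ} {u v : Fin n} → u ≢ v → (∀ k → k ≢ u → k ≢ v → F k ≡ F′ k) →
                             product (tabulate F) * (F′ u * F′ v) ≡ product (tabulate F′) * (F u * F v)
product-tabulate-exchange₂ {n} {F} {F′} {u} {v} u≢v F≗F′ = begin
  P F * (F′ u * F′ v)   ≡⟨ *-assoc (P F) _ _ ⟨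
  P F * F′ u * F′ v     ≡⟨ cong (λ w → P F * w * F′ v) (updateAt-updates u F) ⟨
  P F * H u * F′ v      ≡⟨ cong (_* F′ v) (product-tabulate-exchange u λ k k≢u → sym (updateAt-minimal k u F k≢u)) ⟩
  P H * F u * F′ v      ≡⟨ *-xy∙z≈xz∙y (P H) (F u) (F′ v) ⟩
  P H * F′ v * F u      ≡⟨ cong (_* F u) (product-tabulate-exchange v H≗F′) ⟩
  P F′ * H v * F u      ≡⟨ cong (λ w → P F′ * w * F u) (updateAt-minimal v u F (u≢v ∘ sym)) ⟩
  P F′ * F v * F u      ≡⟨ *-assoc (P F′) _ _ ⟩
  P F′ * (F v * F u)    ≡⟨ cong (P F′ *_) (*-comm (F v) (F u)) ⟩
  P F′ * (F u * F v)    ∎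
  where
  open ≡-Reasoning
  P : (Fin n → ℕ) → ℕ
  P G = product (tabulate G)
  H : Fin n → ℕ
  H = updateAt F u λ _ → F′ u
  H≗F′ : ∀ k → k ≢ v → H k ≡ F′ k
  H≗F′ k k≢v with k ≟ u
  ... | yes refl = updateAt-updates u F
  ... | no k≢u   = trans (updateAt-minimal k u F k≢u) (F≗F′ k k≢u k≢v)

product-tabulate-< : {F F′ : Fin n → ℕ} {u v : Fin n} → u ≢ v → (∀ k → k ≢ u → k ≢ v → F k ≡ F′ k) →
                     (∀ k → NonZero (F′ k)) → F u * F v < F′ u * F′ v → product (tabulate F) < product (tabulate F′)
product-tabulate-< {F = F} {F′} {u} {v} u≢v F≗F′ F′≢0 FuFv<F′uF′v =
  *-cancelʳ-< (F′ u * F′ v) (product (tabulate F)) (product (tabulate F′)) (begin-strict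
    product (tabulate F) * (F′ u * F′ v)   ≡⟨ product-tabulate-exchange₂ u≢v F≗F′ ⟩
    product (tabulate F′) * (F u * F v)    <⟨ *-monoʳ-< _ {{product≢0 (tabulate⁺ F′≢0)}} FuFv<F′uF′v ⟩
    product (tabulate F′) * (F′ u * F′ v)  ∎)
  where open ≤-Reasoning

-- Laplacian degrees

δ≡∑ : (E : Edges n) (i : Fin n) → δ E i ≡ ∑[ j < n ] a E i j
δ≡∑ E i = trans (cong sum (map-tabulate id (a E i))) (sum-tabulate (a E i))

a-diag : (E : Edges n) (i : Fin n) → a E i i ≡ 0
a-diag E i with i ≟ i
... | yes _   = refl
... | no i≢i = contradiction refl i≢i

a-∷ : (x : Subset n) (E : Edges n) (i j : Fin n) → a (x ∷ E) i j ≡ a (x ∷ []) i j + a E i j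
a-∷ x E i j with i ≟ j
... | yes _ = refl
... | no _ with i ∈? x | j ∈? x
...   | yes _ | yes _ = refl
...   | yes _ | no _  = refl
...   | no _  | _     = refl

a-singleton-∈ : {x : Subset n} {i j : Fin n} → i ≢ j → i ∈ x → j ∈ x → a (x ∷ []) i j ≡ 1
a-singleton-∈ {x = x} {i} {j} i≢j i∈x j∈x with i ≟ j
... | yes i≡j = contradiction i≡j i≢j
... | no _ with i ∈? x | j ∈? x
...   | yes _ | yes _   = refl
...   | yes _ | no j∉x  = contradiction j∈x j∉x
...   | no i∉x | _      = contradiction i∈x i∉x

a-singleton-∉ˡ : {x : Subset n} {i : Fin n} → i ∉ x → ∀ j → a (x ∷ []) i j ≡ 0
a-singleton-∉ˡ {x = x} {i} i∉x j with i ≟ j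
... | yes _ = refl
... | no _ with i ∈? x
...   | yes i∈x = contradiction i∈x i∉x
...   | no _    = refl

a-singleton-∉ʳ : {x : Subset n} {j : Fin n} → ∀ i → j ∉ x → a (x ∷ []) i j ≡ 0
a-singleton-∉ʳ {x = x} {j} i j∉x with i ≟ j
... | yes _ = refl
... | no _ with i ∈? x | j ∈? x
...   | yes _ | yes j∈x = contradiction j∈x j∉x
...   | yes _ | no _    = refl
...   | no _  | _       = refl

a-[]∷= : (E : Edges n) (p : Fin (length E)) (x : Subset n) (i j : Fin n) →
         a (E [ p ]∷= x) i j + a (lookup E p ∷ []) i j ≡ a E i j + a (x ∷ []) i j
a-[]∷= (y ∷ E) zero x i j = begin
  a (x ∷ E) i j + a (y ∷ []) i j             ≡⟨ cong (_+ a (y ∷ []) i j) (a-∷ x E i j) ⟩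
  a (x ∷ []) i j + a E i j + a (y ∷ []) i j  ≡⟨ +-xy∙z≈zy∙x (a (x ∷ []) i j) (a E i j) (a (y ∷ []) i j) ⟩
  a (y ∷ []) i j + a E i j + a (x ∷ []) i j  ≡⟨ cong (_+ a (x ∷ []) i j) (a-∷ y E i j) ⟨
  a (y ∷ E) i j + a (x ∷ []) i j             ∎
  where open ≡-Reasoning
a-[]∷= (y ∷ E) (suc p) x i j = begin
  a (y ∷ (E [ p ]∷= x)) i j + a (lookup E p ∷ []) i j             ≡⟨ cong (_+ a (lookup E p ∷ []) i j) (a-∷ y _ i j) ⟩
  a (y ∷ []) i j + a (E [ p ]∷= x) i j + a (lookup E p ∷ []) i j  ≡⟨ +-assoc (a (y ∷ []) i j) _ _ ⟩
  a (y ∷ []) i j + (a (E [ p ]∷= x) i j + a (lookup E p ∷ []) i j) ≡⟨ cong (a (y ∷ []) i j +_) (a-[]∷= E p x i j) ⟩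
  a (y ∷ []) i j + (a E i j + a (x ∷ []) i j)                     ≡⟨ +-assoc (a (y ∷ []) i j) _ _ ⟨
  a (y ∷ []) i j + a E i j + a (x ∷ []) i j                       ≡⟨ cong (_+ a (x ∷ []) i j) (a-∷ y E i j) ⟨
  a (y ∷ E) i j + a (x ∷ []) i j                                  ∎
  where open ≡-Reasoning

δ-[]∷= : (E : Edges n) (p : Fin (length E)) (x : Subset n) (i : Fin n) →
         δ (E [ p ]∷= x) i + δ (lookup E p ∷ []) i ≡ δ E i + δ (x ∷ []) i
δ-[]∷= {n} E p x i = begin
  δ (E [ p ]∷= x) i + δ (lookup E p ∷ []) i                        ≡⟨ cong₂ _+_ (δ≡∑ _ i) (δ≡∑ _ i) ⟩
  ∑[ j < n ] a (E [ p ]∷= x) i j + ∑[ j < n ] a (lookup E p ∷ []) i j ≡⟨ ∑-distrib-+ (a (E [ p ]∷= x) i) (a (lookup E p ∷ []) i) ⟨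
  ∑[ j < n ] (a (E [ p ]∷= x) i j + a (lookup E p ∷ []) i j)        ≡⟨ sum-cong-≗ (a-[]∷= E p x i) ⟩
  ∑[ j < n ] (a E i j + a (x ∷ []) i j)                             ≡⟨ ∑-distrib-+ (a E i) (a (x ∷ []) i) ⟩
  ∑[ j < n ] a E i j + ∑[ j < n ] a (x ∷ []) i j                    ≡⟨ cong₂ _+_ (δ≡∑ E i) (δ≡∑ _ i) ⟨
  δ E i + δ (x ∷ []) i                                              ∎
  where open ≡-Reasoning

δ-singleton-∉ : {x : Subset n} {i : Fin n} → i ∉ x → δ (x ∷ []) i ≡ 0
δ-singleton-∉ {n} {x} {i} i∉x = begin
  δ (x ∷ []) i               ≡⟨ δ≡∑ _ i ⟩
  ∑[ j < n ] a (x ∷ []) i j  ≡⟨ sum-cong-≗ (a-singleton-∉ˡ i∉x) ⟩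
  ∑[ j < n ] 0               ≡⟨ sum-replicate-zero n ⟩
  0                          ∎
  where open ≡-Reasoning

δ-singleton>0 : {x : Subset n} {i : Fin n} → i ∈ x → 2 ≤ ∣ x ∣ → 0 < δ (x ∷ []) i
δ-singleton>0 {n} {x} {i} i∈x 2≤∣x∣ = n≢0⇒n>0 δ≢0
  where
  δ≢0 : δ (x ∷ []) i ≢ 0
  δ≢0 δ≡0 = <⇒≱ 2≤∣x∣ (begin
    ∣ x ∣      ≤⟨ p⊆q⇒∣p∣≤∣q∣ x⊆⁅i⁆ ⟩
    ∣ ⁅ i ⁆ ∣  ≡⟨ ∣⁅x⁆∣≡1 i ⟩
    1          ∎)
    where
    open ≤-Reasoning
    x⊆⁅i⁆ : x ⊆ ⁅ i ⁆
    x⊆⁅i⁆ {k} k∈x with k ≟ i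
    ... | yes refl = x∈⁅x⁆ i
    ... | no k≢i   = contradiction (begin
      1                          ≡⟨ a-singleton-∈ (k≢i ∘ sym) i∈x k∈x ⟨
      a (x ∷ []) i k             ≤⟨ term≤∑ (a (x ∷ []) i) k ⟩
      ∑[ j < n ] a (x ∷ []) i j  ≡⟨ δ≡∑ _ i ⟨
      δ (x ∷ []) i               ≡⟨ δ≡0 ⟩
      0                          ∎) λ ()

module _ (σ : Permutation n n) {x y : Subset n} (y≗x∘σ : ∀ k → Vec.lookup y k ≡ Vec.lookup x (σ ⟨$⟩ʳ k)) where

  private
    ∈-relabel⁺ : ∀ {k} → k ∈ y → σ ⟨$⟩ʳ k ∈ x
    ∈-relabel⁺ {k} k∈y = lookup⇒[]= _ x (trans (sym (y≗x∘σ k)) ([]=⇒lookup k∈y))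

    ∈-relabel⁻ : ∀ {k} → σ ⟨$⟩ʳ k ∈ x → k ∈ y
    ∈-relabel⁻ {k} σk∈x = lookup⇒[]= k y (trans (y≗x∘σ k) ([]=⇒lookup σk∈x))

  a-relabel : ∀ i j → a (y ∷ []) i j ≡ a (x ∷ []) (σ ⟨$⟩ʳ i) (σ ⟨$⟩ʳ j)
  a-relabel i j = by-cases (i ≟ j) (σ ⟨$⟩ʳ i ∈? x) (σ ⟨$⟩ʳ j ∈? x)
    where
    by-cases : Dec (i ≡ j) → Dec (σ ⟨$⟩ʳ i ∈ x) → Dec (σ ⟨$⟩ʳ j ∈ x) →
               a (y ∷ []) i j ≡ a (x ∷ []) (σ ⟨$⟩ʳ i) (σ ⟨$⟩ʳ j)
    by-cases (yes refl) _ _ = trans (a-diag (y ∷ []) i) (sym (a-diag (x ∷ []) (σ ⟨$⟩ʳ i)))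
    by-cases (no i≢j) (yes σi∈x) (yes σj∈x) =
      trans (a-singleton-∈ i≢j (∈-relabel⁻ σi∈x) (∈-relabel⁻ σj∈x))
            (sym (a-singleton-∈ (i≢j ∘ Injection.injective (↔⇒↣ σ)) σi∈x σj∈x))
    by-cases (no _) (no σi∉x) _ =
      trans (a-singleton-∉ˡ (σi∉x ∘ ∈-relabel⁺) j) (sym (a-singleton-∉ˡ σi∉x (σ ⟨$⟩ʳ j)))
    by-cases (no _) (yes _) (no σj∉x) =
      trans (a-singleton-∉ʳ i (σj∉x ∘ ∈-relabel⁺)) (sym (a-singleton-∉ʳ (σ ⟨$⟩ʳ i) σj∉x))

  δ-relabel : ∀ i → δ (y ∷ []) i ≡ δ (x ∷ []) (σ ⟨$⟩ʳ i)
  δ-relabel i = begin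
    δ (y ∷ []) i                                   ≡⟨ δ≡∑ _ i ⟩
    ∑[ j < n ] a (y ∷ []) i j                      ≡⟨ sum-cong-≗ (a-relabel i) ⟩
    ∑[ j < n ] a (x ∷ []) (σ ⟨$⟩ʳ i) (σ ⟨$⟩ʳ j)    ≡⟨ sum-permute (a (x ∷ []) (σ ⟨$⟩ʳ i)) σ ⟨
    ∑[ j < n ] a (x ∷ []) (σ ⟨$⟩ʳ i) j              ≡⟨ δ≡∑ (x ∷ []) (σ ⟨$⟩ʳ i) ⟨
    δ (x ∷ []) (σ ⟨$⟩ʳ i)                          ∎
    where open ≡-Reasoning

-- Moving an edge

transpose-matchˡ : (i j : Fin n) → PC.transpose i j i ≡ j
transpose-matchˡ i j rewrite dec-true (i ≟ i) refl = refl

transpose-matchʳ : {i j : Fin n} → i ≢ j → PC.transpose i j j ≡ i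
transpose-matchʳ {i = i} {j} i≢j rewrite dec-false (j ≟ i) (i≢j ∘ sym) | dec-true (j ≟ j) refl = refl

transpose-fix : {i j k : Fin n} → k ≢ i → k ≢ j → PC.transpose i j k ≡ k
transpose-fix {i = i} {j} {k} k≢i k≢j rewrite dec-false (k ≟ i) k≢i | dec-false (k ≟ j) k≢j = refl

lookup-move : {x : Subset n} {u v : Fin n} → v ∈ x → u ∉ x →
              ∀ k → Vec.lookup ((x [ v ]≔ outside) [ u ]≔ inside) k ≡ Vec.lookup x (PC.transpose u v k)
lookup-move {x = x} {u} {v} v∈x u∉x k = by-cases (k ≟ u) (k ≟ v)
  where
  open ≡-Reasoning
  by-cases : Dec (k ≡ u) → Dec (k ≡ v) →
             Vec.lookup ((x [ v ]≔ outside) [ u ]≔ inside) k ≡ Vec.lookup x (PC.transpose u v k)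
  by-cases (yes refl) _ = begin
    Vec.lookup ((x [ v ]≔ outside) [ k ]≔ inside) k  ≡⟨ lookup∘update k (x [ v ]≔ outside) inside ⟩
    inside                                           ≡⟨ []=⇒lookup v∈x ⟨
    Vec.lookup x v                                   ≡⟨ cong (Vec.lookup x) (transpose-matchˡ k v) ⟨
    Vec.lookup x (PC.transpose k v k)                ∎
  by-cases (no k≢u) (yes refl) = begin
    Vec.lookup ((x [ k ]≔ outside) [ u ]≔ inside) k  ≡⟨ lookup∘update′ k≢u (x [ k ]≔ outside) inside ⟩
    Vec.lookup (x [ k ]≔ outside) k                  ≡⟨ lookup∘update k x outside ⟩
    outside                                          ≡⟨ ¬-not (u∉x ∘ lookup⇒[]= u x) ⟨
    Vec.lookup x u                                   ≡⟨ cong (Vec.lookup x) (transpose-matchʳ (k≢u ∘ sym)) ⟨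
    Vec.lookup x (PC.transpose u k k)                ∎
  by-cases (no k≢u) (no k≢v) = begin
    Vec.lookup ((x [ v ]≔ outside) [ u ]≔ inside) k  ≡⟨ lookup∘update′ k≢u (x [ v ]≔ outside) inside ⟩
    Vec.lookup (x [ v ]≔ outside) k                  ≡⟨ lookup∘update′ k≢v x outside ⟩
    Vec.lookup x k                                   ≡⟨ cong (Vec.lookup x) (transpose-fix k≢u k≢v) ⟨
    Vec.lookup x (PC.transpose u v k)                ∎

module _ (E : Edges n) (p : Fin (length E)) {u v : Fin n} (v∈e : v ∈ lookup E p) (u∉e : u ∉ lookup E p) where

  private
    e = lookup E p
    E′ = moveEdge E p v u

    u≢v : u ≢ v
    u≢v refl = u∉e v∈e

  δ-moveEdge : ∀ k → δ E′ k + δ (e ∷ []) k ≡ δ E k + δ (e ∷ []) (PC.transpose u v k)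
  δ-moveEdge k = trans (δ-[]∷= E p _ k) (cong (δ E k +_) (δ-relabel (transpose u v) (lookup-move v∈e u∉e) k))

  δ-moveEdge-target : δ E′ u ≡ δ (e ∷ []) v + δ E u
  δ-moveEdge-target = begin
    δ E′ u                                   ≡⟨ +-identityʳ _ ⟨
    δ E′ u + 0                               ≡⟨ cong (δ E′ u +_) (δ-singleton-∉ u∉e) ⟨
    δ E′ u + δ (e ∷ []) u                    ≡⟨ δ-moveEdge u ⟩
    δ E u + δ (e ∷ []) (PC.transpose u v u)  ≡⟨ cong (λ k → δ E u + δ (e ∷ []) k) (transpose-matchˡ u v) ⟩
    δ E u + δ (e ∷ []) v                     ≡⟨ +-comm (δ E u) _ ⟩
    δ (e ∷ []) v + δ E u                     ∎
    where open ≡-Reasoning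

  δ-moveEdge-source : δ E v ≡ δ (e ∷ []) v + δ E′ v
  δ-moveEdge-source = begin
    δ E v                                    ≡⟨ +-identityʳ _ ⟨
    δ E v + 0                                ≡⟨ cong (δ E v +_) (δ-singleton-∉ u∉e) ⟨
    δ E v + δ (e ∷ []) u                     ≡⟨ cong (λ k → δ E v + δ (e ∷ []) k) (transpose-matchʳ u≢v) ⟨
    δ E v + δ (e ∷ []) (PC.transpose u v v)  ≡⟨ δ-moveEdge v ⟨
    δ E′ v + δ (e ∷ []) v                    ≡⟨ +-comm (δ E′ v) _ ⟩
    δ (e ∷ []) v + δ E′ v                    ∎
    where open ≡-Reasoning

  δ-moveEdge-other : ∀ k → k ≢ u → k ≢ v → δ E′ k ≡ δ E k
  δ-moveEdge-other k k≢u k≢v = +-cancelʳ-≡ (δ (e ∷ []) k) _ _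
    (trans (δ-moveEdge k) (cong (λ l → δ E k + δ (e ∷ []) l) (transpose-fix k≢u k≢v)))

expH≡product : (E : Edges n) → expH E ≡ product (tabulate (λ i → δ E i ^ δ E i))
expH≡product E = cong product (map-tabulate id (λ i → δ E i ^ δ E i))

expH-transfer-< : (E E′ : Edges n) {u v : Fin n} (m : ℕ) → u ≢ v → 0 < m → δ E v ≤ δ E u →
                  δ E′ u ≡ m + δ E u → δ E v ≡ m + δ E′ v → (∀ k → k ≢ u → k ≢ v → δ E′ k ≡ δ E k) →
                  expH E < expH E′
expH-transfer-< E E′ {u} {v} m u≢v m>0 δv≤δu δ′u≡m+δu δv≡m+δ′v δ′≗δ = begin-strict
  expH E                                 ≡⟨ expH≡product E ⟩
  product (tabulate (λ i → f (δ E i)))   <⟨ product-tabulate-< u≢v (λ k k≢u k≢v → cong f (sym (δ′≗δ k k≢u k≢v)))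
                                                             (λ k → n^n≢0 (δ E′ k)) uv-< ⟩
  product (tabulate (λ i → f (δ E′ i)))  ≡⟨ expH≡product E′ ⟨
  expH E′                                ∎
  where
  open ≤-Reasoning
  f : ℕ → ℕ
  f t = t ^ t
  uv-< : f (δ E u) * f (δ E v) < f (δ E′ u) * f (δ E′ v)
  uv-< = begin-strict
    f (δ E u) * f (δ E v)       ≡⟨ *-comm (f (δ E u)) _ ⟩
    f (δ E v) * f (δ E u)       ≡⟨ cong (λ t → f t * f (δ E u)) δv≡m+δ′v ⟩
    f (m + δ E′ v) * f (δ E u)  <⟨ transfer-< {f} n^n-strictlyLogConvex m>0 (subst (_≤ δ E u) δv≡m+δ′v δv≤δu) ⟩
    f (m + δ E u) * f (δ E′ v)  ≡⟨ cong (λ t → f t * f (δ E′ v)) δ′u≡m+δu ⟨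
    f (δ E′ u) * f (δ E′ v)     ∎

lemma2p4 : (k n : ℕ) → 3 ≤ k → (E : Edges n) →
    Simple E → Uniform k E → Connected E →
    (vi vj : Fin n) → 2 * (k ∸ 1) ≤ δ E vj → δ E vj ≤ δ E vi →
    (p : Fin (length E)) → vj ∈ lookup E p → vi ∉ lookup E p →
    expH E < expH (moveEdge E p vj vi)
lemma2p4 k n 3≤k E _ uniform _ vi vj _ δvj≤δvi p vj∈e vi∉e =
  expH-transfer-< E (moveEdge E p vj vi) (δ (lookup E p ∷ []) vj) vi≢vj
    (δ-singleton>0 vj∈e 2≤∣e∣) δvj≤δvi
    (δ-moveEdge-target E p vj∈e vi∉e) (δ-moveEdge-source E p vj∈e vi∉e) (δ-moveEdge-other E p vj∈e vi∉e)
  where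
  vi≢vj : vi ≢ vj
  vi≢vj refl = vi∉e vj∈e
  2≤∣e∣ : 2 ≤ ∣ lookup E p ∣
  2≤∣e∣ = subst (2 ≤_) (sym (All.lookup uniform (∈-lookup p))) (≤-trans (n≤1+n 2) 3≤k)
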